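{- Let $S$ be a set of $n$ positive integers. There is a bijection between the set of one-row descending plane partitions $a=(a_1,\dots,a_m)$ with no special part, length $m<n$ and $a_1\le n$, and the set of sequences listing all elements of $S$ (each exactly once) with exactly one ascent.
   Context: A one-row descending plane partition is a sequence $(a_1,\dots,a_m)$, $m\ge1$, of positive integers with $a_1\ge\dots\ge a_m$ and $a_1>m$; it has no special part if $a_j\ge j$ for all $1\le j\le m$. A sequence $(s_1,\dots,s_n)$ has an ascent at position $k$ ($1\le k<n$) if $s_k<s_{k+1}$. -}

module Defs where

open import Data.Nat using (ℕ; zero; suc; _≤_; _<_; _≥_; _<ᵇ_)
open import Data.Bool using (if_then_else_)
open import Data.List using (List; []; _∷_; length; lookup)
open import Data.List.Relation.Unary.All using (All)
open import Data.List.Relation.Unary.Linked using (Linked)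
open import Data.List.Relation.Unary.Unique.Propositional using (Unique)
open import Data.List.Relation.Binary.Permutation.Propositional using (_↭_)
open import Data.Fin using (Fin; toℕ)
open import Data.Product using (Σ; _×_; proj₁)
open import Data.Unit using (⊤)
open import Data.Empty using (⊥)
open import Relation.Binary.Bundles using (Setoid)
open import Relation.Binary.PropositionalEquality using (_≡_)
import Relation.Binary.PropositionalEquality as PE
import Relation.Binary.Construct.On as On

IsOneRowDPP : List ℕ → Set
IsOneRowDPP []      = ⊥
IsOneRowDPP (x ∷ t) = All (λ y → 1 ≤ y) (x ∷ t) × Linked _≥_ (x ∷ t) × length (x ∷ t) < x

-- no special part: a_j ≥ j for all 1 ≤ j ≤ m  (index j = toℕ i + 1)
NoSpecialPart : List ℕ → Set
NoSpecialPart a = (i : Fin (length a)) → suc (toℕ i) ≤ lookup a i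

-- first part a₁ ≤ n (the empty list is excluded by IsOneRowDPP anyway)
FirstPartAtMost : ℕ → List ℕ → Set
FirstPartAtMost n []      = ⊤
FirstPartAtMost n (x ∷ _) = x ≤ n

InA : ℕ → List ℕ → Set
InA n a = IsOneRowDPP a × NoSpecialPart a × length a < n × FirstPartAtMost n a

ascents : List ℕ → ℕ
ascents []           = 0
ascents (x ∷ [])     = 0
ascents (x ∷ y ∷ t)  = (if x <ᵇ y then 1 else 0) Data.Nat.+ ascents (y ∷ t)

-- the set B_S: sequences listing every element of S exactly once
-- (i.e. permutations of the duplicate-free list S) with exactly one ascent
InB : List ℕ → List ℕ → Set
InB S s = s ↭ S × ascents s ≡ 1

-- a subset of List ℕ as a setoid; two elements are equal iff the
-- underlying sequences are equal (membership proofs are ignored)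
SubsetSetoid : (List ℕ → Set) → Setoid _ _
SubsetSetoid P = On.setoid {B = Σ (List ℕ) P} (PE.setoid (List ℕ)) proj₁

-- A one-row descending plane partition a with no special part, a₁ ≤ n and
-- m = length a < n is the same as a weakly decreasing list with n ≥ a₁ > m
-- and all parts ≥ m (the condition aₘ ≥ m at the last part propagates up).
-- Drawn as a lattice path from height n down to height m, with a unit
-- down-step for each unit of descent and a mark at the height of each part,
-- it becomes a 0/1-word of length n with m marks in which some mark precedes
-- some down-step.  Aligning the word with the elements of S in decreasing
-- order, the unmarked elements followed by the marked ones, each in
-- decreasing order, form a sequence with exactly one ascent; conversely the
-- word is recovered by testing membership in the part after the ascent.
module Submission where

open import Defs
open import Data.Bool using (Bool; true; false; not; if_then_else_)
open import Data.Empty using (⊥)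
open import Data.Fin using (Fin; toℕ; zero; suc)
open import Data.Fin.Properties using (toℕ<n)
open import Data.List using (List; []; _∷_; _++_; length; lookup; map; filter)
open import Data.List.Properties using (++-identityʳ; length-map; map-∘; map-cong-local; filter-++; filter-all; filter-none)
open import Data.List.Membership.Propositional using (_∈_; _∉_)
open import Data.List.Membership.Propositional.Properties using (∈-lookup; ∈-++⁺ˡ; ∈-++⁺ʳ)
open import Data.List.Relation.Unary.All as All using (All; []; _∷_)
open import Data.List.Relation.Unary.AllPairs as AllPairs using (AllPairs; []; _∷_)
open import Data.List.Relation.Unary.Any using (here; there)
open import Data.List.Relation.Unary.Linked using (Linked; []; [-]; _∷_; tail)
open import Data.List.Relation.Unary.Linked.Properties as Linked using (Linked⇒AllPairs; AllPairs⇒Linked)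
open import Data.List.Relation.Unary.Unique.Propositional using (Unique)
open import Data.List.Relation.Unary.Unique.Propositional.Properties using (Unique[x∷xs]⇒x∉xs)
open import Data.List.Relation.Unary.Sorted.TotalOrder.Properties using (↗↭↗⇒≋)
open import Data.List.Relation.Binary.Pointwise using (Pointwise-≡⇒≡)
open import Data.List.Relation.Binary.Sublist.Propositional using (_⊆_; []; _∷_; _∷ʳ_)
open import Data.List.Relation.Binary.Sublist.Propositional.Properties using (All-resp-⊆; Any-resp-⊆)
open import Data.List.Relation.Binary.Permutation.Propositional using (_↭_; ↭-refl; ↭-reflexive; ↭-trans; ↭-sym; prep; ↭⇒↭ₛ)
open import Data.List.Relation.Binary.Permutation.Propositional.Properties using (shift; filter-↭; ∈-resp-↭; ↭-length)
open import Data.Nat using (ℕ; zero; suc; pred; _+_; _∸_; _≤_; _<_; _≥_; _<ᵇ_; _≟_; z≤n; s≤s)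
open import Data.Nat.Properties
open import Data.Product using (Σ; ∃₂; _×_; _,_; proj₁)
open import Function.Base using (_∘_)
open import Function.Bundles using (Inverse; Bijection; mk⇔)
open import Function.Construct.Composition using (inverse)
open import Function.Properties.Inverse using (Inverse⇒Bijection)
open import Level using (0ℓ)
open import Relation.Binary.Bundles using (Setoid)
open import Relation.Binary.Definitions using (Transitive)
open import Relation.Binary.PropositionalEquality
open import Relation.Binary.Properties.TotalOrder ≤-totalOrder using (≥-totalOrder)
open import Relation.Binary.Properties.DecTotalOrder ≤-decTotalOrder using (≥-decTotalOrder)
open import Relation.Nullary using (¬_; does; ¬?; contradiction)
open import Relation.Nullary.Decidable using (dec-true; dec-false; does-⇔)
open import Relation.Nullary.Reflects using (ofʸ; ofⁿ)
open import Relation.Unary using (Pred; Decidable)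
import Relation.Binary.Construct.On as On

open import Data.List.Membership.DecPropositional _≟_ using (_∈?_)
open import Data.List.Relation.Binary.Permutation.Setoid.Properties (setoid ℕ) using (Unique-resp-↭)
open import Data.List.Sort ≥-decTotalOrder using (sort; sort-↭; sort-↗)

private variable
  A : Set

subsetSetoid : (A : Set) → (A → Set) → Setoid 0ℓ 0ℓ
subsetSetoid A P = On.setoid {B = Σ A P} (setoid A) proj₁

subsetInverse : ∀ {A B : Set} {P : A → Set} {Q : B → Set} (f : A → B) (g : B → A) →
  (∀ {a} → P a → Q (f a)) → (∀ {b} → Q b → P (g b)) →
  (∀ {a} → P a → g (f a) ≡ a) → (∀ {b} → Q b → f (g b) ≡ b) →
  Inverse (subsetSetoid A P) (subsetSetoid B Q)
subsetInverse f g f-∈ g-∈ g∘f f∘g = record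
  { to        = λ (a , a∈) → f a , f-∈ a∈
  ; from      = λ (b , b∈) → g b , g-∈ b∈
  ; to-cong   = cong f
  ; from-cong = cong g
  ; inverse   = (λ {(_ , b∈)} eq → trans (cong f eq) (f∘g b∈))
              , (λ {(_ , a∈)} eq → trans (cong g eq) (g∘f a∈))
  }

falses : List Bool → ℕ
falses []          = 0
falses (false ∷ b) = suc (falses b)
falses (true ∷ b)  = falses b

trues : List Bool → ℕ
trues []          = 0
trues (false ∷ b) = trues b
trues (true ∷ b)  = suc (trues b)

length≡falses+trues : ∀ b → length b ≡ falses b + trues b
length≡falses+trues []          = refl
length≡falses+trues (false ∷ b) = cong suc (length≡falses+trues b)
length≡falses+trues (true ∷ b)  =
  trans (cong suc (length≡falses+trues b)) (sym (+-suc (falses b) (trues b)))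

TrueBeforeFalse : List Bool → Set
TrueBeforeFalse []          = ⊥
TrueBeforeFalse (false ∷ b) = TrueBeforeFalse b
TrueBeforeFalse (true ∷ b)  = 0 < falses b

ValidPath : ℕ → List Bool → Set
ValidPath n b = length b ≡ n × TrueBeforeFalse b

-- A path is walked downwards from a starting height: false is a unit
-- down-step and true records the current height as a part.  path m v a
-- starts at height v, records the parts a and ends at height m.
parts : ℕ → List Bool → List ℕ
parts v []          = []
parts v (false ∷ b) = parts (pred v) b
parts v (true ∷ b)  = v ∷ parts v b

downs : ℕ → List Bool → List Bool
downs zero    b = b
downs (suc k) b = false ∷ downs k b

path : ℕ → ℕ → List ℕ → List Bool
path m v []      = downs (v ∸ m) []
path m v (x ∷ a) = downs (v ∸ x) (true ∷ path m x a)

parts-downs : ∀ v k b → parts v (downs k b) ≡ parts (v ∸ k) b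
parts-downs v       zero    b = refl
parts-downs zero    (suc k) b = trans (parts-downs zero k b) (cong (λ u → parts u b) (0∸n≡0 k))
parts-downs (suc v) (suc k) b = parts-downs v k b

falses-downs : ∀ k b → falses (downs k b) ≡ k + falses b
falses-downs zero    b = refl
falses-downs (suc k) b = cong suc (falses-downs k b)

trues-downs : ∀ k b → trues (downs k b) ≡ trues b
trues-downs zero    b = refl
trues-downs (suc k) b = trues-downs k b

trueBeforeFalse-downs : ∀ k {b} → TrueBeforeFalse b → TrueBeforeFalse (downs k b)
trueBeforeFalse-downs zero    tbf = tbf
trueBeforeFalse-downs (suc k) tbf = trueBeforeFalse-downs k tbf

parts-path : ∀ m v a → Linked _≥_ (v ∷ a) → parts v (path m v a) ≡ a
parts-path m v [] _ = parts-downs v (v ∸ m) []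
parts-path m v (x ∷ a) (x≤v ∷ desc) = begin
  parts v (downs (v ∸ x) (true ∷ path m x a)) ≡⟨ parts-downs v (v ∸ x) _ ⟩
  parts (v ∸ (v ∸ x)) (true ∷ path m x a)      ≡⟨ cong (λ u → parts u (true ∷ path m x a)) (m∸[m∸n]≡n x≤v) ⟩
  x ∷ parts x (path m x a)                     ≡⟨ cong (x ∷_) (parts-path m x a desc) ⟩
  x ∷ a                                        ∎
  where open ≡-Reasoning

falses-path : ∀ m v a → Linked _≥_ (v ∷ a) → All (m ≤_) (v ∷ a) → falses (path m v a) + m ≡ v
falses-path m v [] _ (m≤v ∷ []) =
  trans (cong (_+ m) (trans (falses-downs (v ∸ m) []) (+-identityʳ _))) (m∸n+n≡m m≤v)
falses-path m v (x ∷ a) (x≤v ∷ desc) (_ ∷ bounds) = begin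
  falses (downs (v ∸ x) (true ∷ path m x a)) + m ≡⟨ cong (_+ m) (falses-downs (v ∸ x) _) ⟩
  (v ∸ x) + falses (path m x a) + m            ≡⟨ +-assoc (v ∸ x) _ m ⟩
  (v ∸ x) + (falses (path m x a) + m)          ≡⟨ cong ((v ∸ x) +_) (falses-path m x a desc bounds) ⟩
  (v ∸ x) + x                                  ≡⟨ m∸n+n≡m x≤v ⟩
  v                                            ∎
  where open ≡-Reasoning

trues-path : ∀ m v a → trues (path m v a) ≡ length a
trues-path m v []      = trues-downs (v ∸ m) []
trues-path m v (x ∷ a) = trans (trues-downs (v ∸ x) _) (cong suc (trues-path m x a))

path-suc : ∀ m w a → Linked _≥_ (w ∷ a) → m ≤ w → path m (suc w) a ≡ false ∷ path m w a
path-suc m w []      _           m≤w = cong (λ k → downs k []) (+-∸-assoc 1 m≤w)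
path-suc m w (x ∷ a) (x≤w ∷ _) _   = cong (λ k → downs k (true ∷ path m x a)) (+-∸-assoc 1 x≤w)

Linked-≥-raise : ∀ {w v l} → w ≤ v → Linked _≥_ (w ∷ l) → Linked _≥_ (v ∷ l)
Linked-≥-raise         _   [-]          = [-]
Linked-≥-raise w≤v (y≤w ∷ desc) = ≤-trans y≤w w≤v ∷ desc

parts-descending : ∀ v b → Linked _≥_ (v ∷ parts v b)
parts-descending v []          = [-]
parts-descending v (false ∷ b) = Linked-≥-raise pred[n]≤n (parts-descending (pred v) b)
parts-descending v (true ∷ b)  = ≤-refl ∷ parts-descending v b

parts-atLeast : ∀ m v b → v ≡ falses b + m → All (m ≤_) (parts v b)
parts-atLeast m v []          _  = []
parts-atLeast m v (false ∷ b) eq = parts-atLeast m (pred v) b (cong pred eq)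
parts-atLeast m v (true ∷ b)  eq = subst (m ≤_) (sym eq) (m≤n+m m (falses b)) ∷ parts-atLeast m v b eq

length-parts : ∀ v b → length (parts v b) ≡ trues b
length-parts v []          = refl
length-parts v (false ∷ b) = length-parts (pred v) b
length-parts v (true ∷ b)  = cong suc (length-parts v b)

path-parts : ∀ m v b → v ≡ falses b + m → path m v (parts v b) ≡ b
path-parts m v [] refl = cong (λ k → downs k []) (n∸n≡0 m)
path-parts m v (true ∷ b) eq =
  cong₂ (λ k c → downs k (true ∷ c)) (n∸n≡0 v) (path-parts m v b eq)
path-parts m .(suc (falses b + m)) (false ∷ b) refl = begin
  path m (suc w) (parts w b)   ≡⟨ path-suc m w (parts w b) (parts-descending w b) (m≤n+m m (falses b)) ⟩
  false ∷ path m w (parts w b) ≡⟨ cong (false ∷_) (path-parts m w b refl) ⟩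
  false ∷ b                    ∎
  where
  open ≡-Reasoning
  w = falses b + m

Bounded : ℕ → ℕ → List ℕ → Set
Bounded m v []      = ⊥
Bounded m v (x ∷ a) = Linked _≥_ (v ∷ x ∷ a) × All (m ≤_) (x ∷ a) × m < x

Bounded-raise : ∀ {m w v} a → w ≤ v → Bounded m w a → Bounded m v a
Bounded-raise (x ∷ a) w≤v (desc , bounds , m<x) = Linked-≥-raise w≤v desc , bounds , m<x

parts-bounded : ∀ m v b → TrueBeforeFalse b → v ≡ falses b + m → Bounded m v (parts v b)
parts-bounded m v (false ∷ b) tbf eq =
  Bounded-raise (parts (pred v) b) pred[n]≤n (parts-bounded m (pred v) b tbf (cong pred eq))
parts-bounded m v (true ∷ b) 0<f eq =
  ≤-refl ∷ parts-descending v b ,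
  parts-atLeast m v (true ∷ b) eq ,
  subst (m <_) (sym eq) (m<n+m m 0<f)

shiftedNoSpecialPart⇒atLeast : ∀ k a → Linked _≥_ a →
  (∀ (i : Fin (length a)) → k + suc (toℕ i) ≤ lookup a i) → All (k + length a ≤_) a
shiftedNoSpecialPart⇒atLeast k []          _            _     = []
shiftedNoSpecialPart⇒atLeast k (x ∷ [])    _            above = above zero ∷ []
shiftedNoSpecialPart⇒atLeast k (x ∷ y ∷ a) (y≤x ∷ desc) above = ≤-trans (All.head rest) y≤x ∷ rest
  where
  rest : All (k + length (x ∷ y ∷ a) ≤_) (y ∷ a)
  rest = subst (λ c → All (c ≤_) (y ∷ a)) (sym (+-suc k (length (y ∷ a))))
           (shiftedNoSpecialPart⇒atLeast (suc k) (y ∷ a) desc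
             (λ i → subst (_≤ lookup (y ∷ a) i) (+-suc k (suc (toℕ i))) (above (suc i))))

noSpecialPart⇒atLeastLength : ∀ a → Linked _≥_ a → NoSpecialPart a → All (length a ≤_) a
noSpecialPart⇒atLeastLength = shiftedNoSpecialPart⇒atLeast 0

atLeastLength⇒noSpecialPart : ∀ a → All (length a ≤_) a → NoSpecialPart a
atLeastLength⇒noSpecialPart a bounds i = ≤-trans (toℕ<n i) (All.lookup bounds (∈-lookup i))

InA⇒Bounded : ∀ n a → InA n a → Bounded (length a) n a
InA⇒Bounded n (x ∷ a) ((_ , desc , m<x) , noSpecial , _ , x≤n) =
  x≤n ∷ desc , noSpecialPart⇒atLeastLength (x ∷ a) desc noSpecial , m<x

Bounded⇒InA : ∀ n a → Bounded (length a) n a → InA n a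
Bounded⇒InA n (x ∷ a) (x≤n ∷ desc , bounds , m<x) =
  (All.map (≤-trans (s≤s z≤n)) bounds , desc , m<x) ,
  atLeastLength⇒noSpecialPart (x ∷ a) bounds ,
  <-≤-trans m<x x≤n ,
  x≤n

path-ValidPath : ∀ {n} a → Bounded (length a) n a → ValidPath n (path (length a) n a)
path-ValidPath {n} (x ∷ a) (desc@(x≤n ∷ descₓ) , bounds@(m≤x ∷ _) , m<x) = length≡n , trueBeforeFalse
  where
  m = length (x ∷ a)
  p = path m n (x ∷ a)
  length≡n : length p ≡ n
  length≡n = begin
    length p              ≡⟨ length≡falses+trues p ⟩
    falses p + trues p    ≡⟨ cong (falses p +_) (trues-path m n (x ∷ a)) ⟩
    falses p + m          ≡⟨ falses-path m n (x ∷ a) desc (≤-trans m≤x x≤n ∷ bounds) ⟩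
    n                     ∎
    where open ≡-Reasoning
  trueBeforeFalse : TrueBeforeFalse (path m n (x ∷ a))
  trueBeforeFalse = trueBeforeFalse-downs (n ∸ x)
    (+-cancelʳ-< m 0 _ (subst (m <_) (sym (falses-path m x a descₓ bounds)) m<x))

Bounded-descending : ∀ {m v} a → Bounded m v a → Linked _≥_ (v ∷ a)
Bounded-descending (x ∷ a) (desc , _) = desc

ValidPath-falses+trues : ∀ {n} b → ValidPath n b → n ≡ falses b + trues b
ValidPath-falses+trues b (refl , _) = length≡falses+trues b

parts-InA : ∀ n b → ValidPath n b → InA n (parts n b)
parts-InA n b (len , tbf) = Bounded⇒InA n (parts n b)
  (subst (λ m → Bounded m n (parts n b)) (sym (length-parts n b))
    (parts-bounded (trues b) n b tbf (ValidPath-falses+trues b (len , tbf))))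

path-parts-ValidPath : ∀ n b → ValidPath n b → path (length (parts n b)) n (parts n b) ≡ b
path-parts-ValidPath n b valid = trans (cong (λ m → path m n (parts n b)) (length-parts n b))
  (path-parts (trues b) n b (ValidPath-falses+trues b valid))

partsInverse : ∀ n → Inverse (subsetSetoid (List ℕ) (InA n)) (subsetSetoid (List Bool) (ValidPath n))
partsInverse n = subsetInverse (λ a → path (length a) n a) (parts n)
  (λ {a} a∈ → path-ValidPath a (InA⇒Bounded n a a∈))
  (λ {b} → parts-InA n b)
  (λ {a} a∈ → parts-path (length a) n a (Bounded-descending a (InA⇒Bounded n a a∈)))
  (λ {b} → path-parts-ValidPath n b)

≥-trans : Transitive _≥_
≥-trans y≤x z≤y = ≤-trans z≤y y≤x

select : List Bool → List A → List A
select []          _       = []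
select (_ ∷ _)     []      = []
select (true ∷ b)  (d ∷ D) = d ∷ select b D
select (false ∷ b) (d ∷ D) = select b D

select-⊆ : ∀ b (D : List A) → select b D ⊆ D
select-⊆ []          []      = []
select-⊆ []          (d ∷ D) = d ∷ʳ select-⊆ [] D
select-⊆ (_ ∷ _)     []      = []
select-⊆ (true ∷ b)  (d ∷ D) = refl ∷ select-⊆ b D
select-⊆ (false ∷ b) (d ∷ D) = d ∷ʳ select-⊆ b D

AllPairs-resp-⊆ : ∀ {R : A → A → Set} {xs ys} → xs ⊆ ys → AllPairs R ys → AllPairs R xs
AllPairs-resp-⊆ []         []         = []
AllPairs-resp-⊆ (y ∷ʳ sub) (_ ∷ rys)  = AllPairs-resp-⊆ sub rys
AllPairs-resp-⊆ (refl ∷ sub) (ry ∷ rys) = All-resp-⊆ sub ry ∷ AllPairs-resp-⊆ sub rys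

Linked-select : ∀ {R : A → A → Set} → Transitive R → ∀ b {D} → Linked R D → Linked R (select b D)
Linked-select trans b {D} = AllPairs⇒Linked ∘ AllPairs-resp-⊆ (select-⊆ b D) ∘ Linked⇒AllPairs trans

arrange : List A → List Bool → List A
arrange D b = select (map not b) D ++ select b D

arrange-↭ : ∀ b (D : List A) → length b ≡ length D → arrange D b ↭ D
arrange-↭ []          []      _  = ↭-refl
arrange-↭ (false ∷ b) (d ∷ D) eq = prep d (arrange-↭ b D (suc-injective eq))
arrange-↭ (true ∷ b)  (d ∷ D) eq =
  ↭-trans (shift d (select (map not b) D) (select b D)) (prep d (arrange-↭ b D (suc-injective eq)))

mask : List ℕ → List ℕ → List Bool
mask D Q = map (λ d → does (d ∈? Q)) D

mask-select : ∀ b D → Unique D → length b ≡ length D → mask D (select b D) ≡ b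
mask-select []          []      _            _  = refl
mask-select (true ∷ b)  (d ∷ D) (d∉ ∷ uD) eq =
  cong₂ _∷_ (dec-true (d ∈? d ∷ select b D) (here refl))
    (trans (map-cong-local (All.map skip d∉)) (mask-select b D uD (suc-injective eq)))
  where
  skip : ∀ {e} → d ≢ e → does (e ∈? d ∷ select b D) ≡ does (e ∈? select b D)
  skip {e} d≢e = does-⇔ (mk⇔ (λ { (here e≡d) → contradiction (sym e≡d) d≢e ; (there e∈) → e∈ }) there)
    (e ∈? d ∷ select b D) (e ∈? select b D)
mask-select (false ∷ b) (d ∷ D) (d∉ ∷ uD) eq =
  cong₂ _∷_ (dec-false (d ∈? select b D) (Unique[x∷xs]⇒x∉xs (d∉ ∷ uD) ∘ Any-resp-⊆ (select-⊆ b D)))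
    (mask-select b D uD (suc-injective eq))

AllPairs-++-across : ∀ {R : A → A → Set} xs {ys r q} → AllPairs R (xs ++ ys) → r ∈ xs → q ∈ ys → R r q
AllPairs-++-across (_ ∷ xs) (r≺ ∷ _) (here refl) q∈ = All.lookup r≺ (∈-++⁺ʳ xs q∈)
AllPairs-++-across (_ ∷ xs) (_ ∷ pairs) (there r∈) q∈ = AllPairs-++-across xs pairs r∈ q∈

descending⇒ascents≡0 : ∀ {s} → Linked _≥_ s → ascents s ≡ 0
descending⇒ascents≡0 []  = refl
descending⇒ascents≡0 [-] = refl
descending⇒ascents≡0 {x ∷ y ∷ _} (y≤x ∷ desc) with x <ᵇ y | <ᵇ-reflects-< x y
... | true  | ofʸ x<y = contradiction y≤x (<⇒≱ x<y)
... | false | _       = descending⇒ascents≡0 desc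

ascents≡0⇒descending : ∀ s → ascents s ≡ 0 → Linked _≥_ s
ascents≡0⇒descending []          _  = []
ascents≡0⇒descending (x ∷ [])    _  = [-]
ascents≡0⇒descending (x ∷ y ∷ s) eq =
  noAscent (m+n≡0⇒m≡0 _ eq) ∷ ascents≡0⇒descending (y ∷ s) (m+n≡0⇒n≡0 _ eq)
  where
  noAscent : (if x <ᵇ y then 1 else 0) ≡ 0 → y ≤ x
  noAscent eq with x <ᵇ y | <ᵇ-reflects-< x y
  ... | false | ofⁿ x≮y = ≮⇒≥ x≮y

ascents-++ : ∀ xs ys → ascents (xs ++ ys) ≤ ascents xs + suc (ascents ys)
ascents-++ []               ys       = n≤1+n (ascents ys)
ascents-++ (x ∷ [])         []       = z≤n
ascents-++ (x ∷ [])         (y ∷ ys) = +-monoˡ-≤ (ascents (y ∷ ys)) (indicator≤1 (x <ᵇ y))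
  where
  indicator≤1 : ∀ c → (if c then 1 else 0) ≤ 1
  indicator≤1 true  = ≤-refl
  indicator≤1 false = z≤n
ascents-++ (x ∷ x′ ∷ xs)    ys       = begin
  c + ascents (x′ ∷ xs ++ ys)              ≤⟨ +-monoʳ-≤ c (ascents-++ (x′ ∷ xs) ys) ⟩
  c + (ascents (x′ ∷ xs) + suc (ascents ys)) ≡⟨ +-assoc c _ _ ⟨
  c + ascents (x′ ∷ xs) + suc (ascents ys)   ∎
  where
  open ≤-Reasoning
  c = if x <ᵇ x′ then 1 else 0

¬descending-++ : ∀ xs {ys r q} → r ∈ xs → q ∈ ys → r < q → ¬ Linked _≥_ (xs ++ ys)
¬descending-++ xs r∈ q∈ r<q desc = <⇒≱ r<q (AllPairs-++-across xs (Linked⇒AllPairs ≥-trans desc) r∈ q∈)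

ascents≡1 : ∀ {xs ys} → Linked _≥_ xs → Linked _≥_ ys → ¬ Linked _≥_ (xs ++ ys) → ascents (xs ++ ys) ≡ 1
ascents≡1 {xs} {ys} dxs dys ¬desc = ≤-antisym atMostOne (n≢0⇒n>0 (¬desc ∘ ascents≡0⇒descending (xs ++ ys)))
  where
  atMostOne : ascents (xs ++ ys) ≤ 1
  atMostOne = subst₂ (λ a b → ascents (xs ++ ys) ≤ a + suc b)
                (descending⇒ascents≡0 dxs) (descending⇒ascents≡0 dys) (ascents-++ xs ys)

afterFirstAscent : List ℕ → List ℕ
afterFirstAscent []          = []
afterFirstAscent (x ∷ [])    = []
afterFirstAscent (x ∷ y ∷ s) = if x <ᵇ y then y ∷ s else afterFirstAscent (y ∷ s)

afterFirstAscent-++ : ∀ {xs ys} → Linked _≥_ xs → Linked _≥_ ys → ¬ Linked _≥_ (xs ++ ys) →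
  afterFirstAscent (xs ++ ys) ≡ ys
afterFirstAscent-++ {[]}        _ dys ¬desc = contradiction dys ¬desc
afterFirstAscent-++ {x ∷ []} {[]} _ _ ¬desc = contradiction [-] ¬desc
afterFirstAscent-++ {x ∷ []} {y ∷ ys} _ dys ¬desc with x <ᵇ y | <ᵇ-reflects-< x y
... | true  | _       = refl
... | false | ofⁿ x≮y = contradiction (≮⇒≥ x≮y ∷ dys) ¬desc
afterFirstAscent-++ {x ∷ x′ ∷ xs} (x′≤x ∷ dxs) dys ¬desc with x <ᵇ x′ | <ᵇ-reflects-< x x′
... | true  | ofʸ x<x′ = contradiction x′≤x (<⇒≱ x<x′)
... | false | _        = afterFirstAscent-++ dxs dys (¬desc ∘ (x′≤x ∷_))

record AscentSplit (s : List ℕ) : Set where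
  constructor ascentSplit
  field
    run rest  : List ℕ
    s≡        : s ≡ run ++ rest
    run↘      : Linked _≥_ run
    rest↘     : Linked _≥_ rest
    low high  : ℕ
    low∈run   : low ∈ run
    high∈rest : high ∈ rest
    low<high  : low < high

ascents≡1⇒split : ∀ x s → ascents (x ∷ s) ≡ 1 → AscentSplit (x ∷ s)
ascents≡1⇒split x (y ∷ s) eq with x <ᵇ y | <ᵇ-reflects-< x y
... | true  | ofʸ x<y = ascentSplit (x ∷ []) (y ∷ s) refl [-]
  (ascents≡0⇒descending (y ∷ s) (suc-injective eq)) x y (here refl) (here refl) x<y
... | false | ofⁿ x≮y with ascents≡1⇒split y s eq
...   | ascentSplit (y ∷ run) rest refl run↘ rest↘ low high low∈ high∈ low<high =
  ascentSplit (x ∷ y ∷ run) rest refl (≮⇒≥ x≮y ∷ run↘) rest↘ low high (there low∈) high∈ low<high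

≤-head : ∀ {d D z} → Linked _≥_ (d ∷ D) → z ∈ D → z ≤ d
≤-head desc z∈ = All.lookup (AllPairs.head (Linked⇒AllPairs ≥-trans desc)) z∈

<-head : ∀ {d D z} → Linked _≥_ (d ∷ D) → Unique (d ∷ D) → z ∈ D → z < d
<-head desc (d≢ ∷ _) z∈ = ≤∧≢⇒< (≤-head desc z∈) (λ z≡d → All.lookup d≢ z∈ (sym z≡d))

select-not-nonempty : ∀ b (D : List A) → 0 < falses b → length b ≡ length D → Σ A (_∈ select (map not b) D)
select-not-nonempty (false ∷ b) (d ∷ D) _   _  = d , here refl
select-not-nonempty (true ∷ b)  (d ∷ D) 0<f eq = select-not-nonempty b D 0<f (suc-injective eq)

arrange-junction : ∀ b D → Linked _≥_ D → Unique D → length b ≡ length D → TrueBeforeFalse b →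
  ∃₂ λ r q → r ∈ select (map not b) D × q ∈ select b D × r < q
arrange-junction (false ∷ b) (d ∷ D) desc (_ ∷ uD) eq tbf with arrange-junction b D (tail desc) uD (suc-injective eq) tbf
... | r , q , r∈ , q∈ , r<q = r , q , there r∈ , q∈ , r<q
arrange-junction (true ∷ b) (d ∷ D) desc uD eq 0<f with select-not-nonempty b D 0<f (suc-injective eq)
... | r , r∈ = r , d , r∈ , here refl , <-head desc uD (Any-resp-⊆ (select-⊆ (map not b) D) r∈)

arrange-¬descending : ∀ b D → Linked _≥_ D → Unique D → length b ≡ length D → TrueBeforeFalse b →
  ¬ Linked _≥_ (arrange D b)
arrange-¬descending b D desc unique eq tbf with arrange-junction b D desc unique eq tbf
... | r , q , r∈ , q∈ , r<q = ¬descending-++ (select (map not b) D) r∈ q∈ r<q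

falses-map : ∀ (g : A → Bool) D {z} → z ∈ D → g z ≡ false → 0 < falses (map g D)
falses-map g (d ∷ D) (here refl) gz rewrite gz = s≤s z≤n
falses-map g (d ∷ D) (there z∈) gz with g d
... | false = s≤s z≤n
... | true  = falses-map g D z∈ gz

trueBeforeFalse-map : ∀ (g : ℕ → Bool) D {q r} → Linked _≥_ D → q ∈ D → r ∈ D → r < q →
  g q ≡ true → g r ≡ false → TrueBeforeFalse (map g D)
trueBeforeFalse-map g (d ∷ D) _    (here refl) (here refl) r<q _  _  = contradiction r<q (<-irrefl refl)
trueBeforeFalse-map g (d ∷ D) _    (here refl) (there r∈)  _   gq gr rewrite gq = falses-map g D r∈ gr
trueBeforeFalse-map g (d ∷ D) desc (there q∈)  (here refl) r<q _  _  = contradiction (≤-head desc q∈) (<⇒≱ r<q)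
trueBeforeFalse-map g (d ∷ D) desc (there q∈)  (there r∈)  r<q gq gr with g d
... | true  = falses-map g D r∈ gr
... | false = trueBeforeFalse-map g D (tail desc) q∈ r∈ r<q gq gr

Unique-++-disjoint : ∀ (xs : List A) {ys z} → Unique (xs ++ ys) → z ∈ xs → z ∉ ys
Unique-++-disjoint xs unique z∈xs z∈ys = AllPairs-++-across xs unique z∈xs z∈ys refl

descending-↭⇒≡ : ∀ {xs ys} → Linked _≥_ xs → Linked _≥_ ys → xs ↭ ys → xs ≡ ys
descending-↭⇒≡ dxs dys p = Pointwise-≡⇒≡ (↗↭↗⇒≋ ≥-totalOrder dxs dys (↭⇒↭ₛ p))

select-filter : ∀ {P : Pred A 0ℓ} (P? : Decidable P) D → select (map (does ∘ P?) D) D ≡ filter P? D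
select-filter P? []      = refl
select-filter P? (d ∷ D) with does (P? d)
... | true  = cong (d ∷_) (select-filter P? D)
... | false = select-filter P? D

filter-descending : ∀ {P : Pred ℕ 0ℓ} (P? : Decidable P) {D xs ys} → Linked _≥_ D → Linked _≥_ ys →
  D ↭ xs → filter P? xs ≡ ys → filter P? D ≡ ys
filter-descending P? dD dys D↭xs eq =
  descending-↭⇒≡ (Linked.filter⁺ P? ≥-trans dD) dys (↭-trans (filter-↭ P? D↭xs) (↭-reflexive eq))

module _ (R Q : List ℕ) (unique : Unique (R ++ Q)) where

  private
    disjoint : ∀ {z} → z ∈ R → z ∉ Q
    disjoint = Unique-++-disjoint R unique

  filter-∈-++ : filter (_∈? Q) (R ++ Q) ≡ Q
  filter-∈-++ = begin
    filter (_∈? Q) (R ++ Q)               ≡⟨ filter-++ (_∈? Q) R Q ⟩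
    filter (_∈? Q) R ++ filter (_∈? Q) Q  ≡⟨ cong₂ _++_ (filter-none (_∈? Q) (All.tabulate disjoint))
                                                        (filter-all (_∈? Q) (All.tabulate (λ z∈ → z∈))) ⟩
    Q                                     ∎
    where open ≡-Reasoning

  filter-∉-++ : filter (λ z → ¬? (z ∈? Q)) (R ++ Q) ≡ R
  filter-∉-++ = begin
    filter ∉Q? (R ++ Q)           ≡⟨ filter-++ ∉Q? R Q ⟩
    filter ∉Q? R ++ filter ∉Q? Q  ≡⟨ cong₂ _++_ (filter-all ∉Q? (All.tabulate disjoint))
                                                (filter-none ∉Q? (All.tabulate (λ z∈ z∉ → z∉ z∈))) ⟩
    R ++ []                       ≡⟨ ++-identityʳ R ⟩
    R                             ∎
    where
    open ≡-Reasoning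
    ∉Q? : Decidable (_∉ Q)
    ∉Q? z = ¬? (z ∈? Q)

arrange-mask : ∀ {D R Q} → Linked _≥_ D → Linked _≥_ R → Linked _≥_ Q → Unique (R ++ Q) → D ↭ R ++ Q →
  arrange D (mask D Q) ≡ R ++ Q
arrange-mask {D} {R} {Q} dD dR dQ unique D↭ = cong₂ _++_ run rest
  where
  run : select (map not (mask D Q)) D ≡ R
  run = begin
    select (map not (mask D Q)) D  ≡⟨ cong (λ c → select c D) (map-∘ D) ⟨
    select (map (does ∘ ∉Q?) D) D  ≡⟨ select-filter ∉Q? D ⟩
    filter ∉Q? D                   ≡⟨ filter-descending ∉Q? dD dR D↭ (filter-∉-++ R Q unique) ⟩
    R                              ∎
    where
    open ≡-Reasoning
    ∉Q? : Decidable (_∉ Q)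
    ∉Q? z = ¬? (z ∈? Q)
  rest : select (mask D Q) D ≡ Q
  rest = trans (select-filter (_∈? Q) D) (filter-descending (_∈? Q) dD dQ D↭ (filter-∈-++ R Q unique))

module _ (S : List ℕ) (uniqueS : Unique S) where

  private
    n = length S
    D = sort S
    D↭S : D ↭ S
    D↭S = sort-↭ S
    D↘ : Linked _≥_ D
    D↘ = sort-↗ S
    unique-↭S : ∀ {s} → s ↭ S → Unique s
    unique-↭S s↭S = Unique-resp-↭ (↭⇒↭ₛ (↭-sym s↭S)) uniqueS
    length-D : ∀ (b : List Bool) → length b ≡ n → length b ≡ length D
    length-D _ len = trans len (sym (↭-length D↭S))

    unmarked↘ : ∀ b → Linked _≥_ (select (map not b) D)
    unmarked↘ b = Linked-select ≥-trans (map not b) D↘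

    marked↘ : ∀ b → Linked _≥_ (select b D)
    marked↘ b = Linked-select ≥-trans b D↘

    arrange-¬↘ : ∀ b → ValidPath n b → ¬ Linked _≥_ (arrange D b)
    arrange-¬↘ b (len , tbf) = arrange-¬descending b D D↘ (unique-↭S D↭S) (length-D b len) tbf

  arrange-InB : ∀ b → ValidPath n b → InB S (arrange D b)
  arrange-InB b valid@(len , _) =
    ↭-trans (arrange-↭ b D (length-D b len)) D↭S ,
    ascents≡1 (unmarked↘ b) (marked↘ b) (arrange-¬↘ b valid)

  mask-arrange : ∀ b → ValidPath n b → mask D (afterFirstAscent (arrange D b)) ≡ b
  mask-arrange b valid@(len , _) = begin
    mask D (afterFirstAscent (arrange D b))
      ≡⟨ cong (mask D) (afterFirstAscent-++ (unmarked↘ b) (marked↘ b) (arrange-¬↘ b valid)) ⟩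
    mask D (select b D)                     ≡⟨ mask-select b D (unique-↭S D↭S) (length-D b len) ⟩
    b                                       ∎
    where open ≡-Reasoning

  InB-split : ∀ s → InB S s → AscentSplit s
  InB-split (x ∷ t) (_ , eq) = ascents≡1⇒split x t eq

  mask-ValidPath : ∀ s → InB S s → ValidPath n (mask D (afterFirstAscent s))
  mask-ValidPath s inB@(s↭S , _) with InB-split s inB
  ... | ascentSplit run rest refl run↘ rest↘ low high low∈ high∈ low<high
    rewrite afterFirstAscent-++ run↘ rest↘ (¬descending-++ run low∈ high∈ low<high) =
    trans (length-map _ D) (↭-length D↭S) ,
    trueBeforeFalse-map (λ d → does (d ∈? rest)) D D↘
      (toD (∈-++⁺ʳ run high∈)) (toD (∈-++⁺ˡ low∈)) low<high
      (dec-true (high ∈? rest) high∈)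
      (dec-false (low ∈? rest) (Unique-++-disjoint run (unique-↭S s↭S) low∈))
    where
    toD : ∀ {z} → z ∈ run ++ rest → z ∈ D
    toD = ∈-resp-↭ (↭-trans s↭S (↭-sym D↭S))

  arrange-mask-InB : ∀ s → InB S s → arrange D (mask D (afterFirstAscent s)) ≡ s
  arrange-mask-InB s inB@(s↭S , _) with InB-split s inB
  ... | ascentSplit run rest refl run↘ rest↘ low high low∈ high∈ low<high
    rewrite afterFirstAscent-++ run↘ rest↘ (¬descending-++ run low∈ high∈ low<high) =
    arrange-mask D↘ run↘ rest↘ (unique-↭S s↭S) (↭-trans D↭S (↭-sym s↭S))

  arrangeInverse : Inverse (subsetSetoid (List Bool) (ValidPath n)) (subsetSetoid (List ℕ) (InB S))
  arrangeInverse = subsetInverse (arrange D) (λ s → mask D (afterFirstAscent s))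
    (λ {b} → arrange-InB b) (λ {s} → mask-ValidPath s) (λ {b} → mask-arrange b) (λ {s} → arrange-mask-InB s)

lemma4p2 : (S : List ℕ) → Unique S → All (λ x → 0 < x) S →
           Bijection (SubsetSetoid (InA (length S))) (SubsetSetoid (InB S))
lemma4p2 S uniqueS _ =
  Inverse⇒Bijection (inverse (partsInverse (length S)) (arrangeInverse S uniqueS))
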